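{- In the $(1:1)$ WMaker--WBreaker game on $E(K_n)$, if WMaker plays according to strategy $\mathcal{S}$, then, as long as $|U|>2$, after each round every edge claimed by WBreaker is incident with some vertex of $V(M)$.
   Context: The $(1:1)$ WMaker--WBreaker game on $E(K_n)$: WMaker and WBreaker alternately claim one edge of $K_n$ per turn; both are walkers: at the first move a player chooses any starting vertex; when positioned at $v$, a player may only claim an edge incident with $v$ not previously claimed by the opponent, and its other endpoint becomes the new position. WBreaker starts; a round is a move of WBreaker followed by a move of WMaker. $M$ and $B$ denote the graphs of edges claimed so far by WMaker and WBreaker; $V(M)$ is the set of vertices incident with at least one WMaker edge, and $U=V(K_n)\setminus V(M)$ is the set of vertices unvisited by WMaker. An edge is free if claimed by neither player. $d_B(x)$ is the degree of $x$ in $B$, and for $A\subseteq V$, $d_B(x,A)$ is the number of WBreaker edges from $x$ to $A$. Strategy $\mathcal{S}$ for WMaker: as her starting vertex she takes the vertex $v_1$ at which WBreaker finished his first move, and claims an edge $v_1u$ with $d_B(u)=0$ (ties arbitrary). In every later round, with current position $w$: if there is an edge $pq\in E(B)$ with $p,q\in U$, she claims $wp$ or $wq$, whichever is free; if both are free she chooses $wp$ if $d_B(p)>d_B(q)$ and $wq$ if $d_B(q)>d_B(p)$ (ties arbitrary). If no such edge exists, then, as long as $|U|\ge 3$, she claims a free edge $wu$ with $u\in U$ and $d_B(u)=\max\{d_B(v):v\in U\}$ (ties arbitrary); if all free edges $wu$ are such that $d_B(u)=0$ for all $u\in U$, she claims an arbitrary free edge $wu$. -}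

module Defs where

open import Data.Nat using (ℕ; zero; suc; _≤_; _<_)
open import Data.Fin using (Fin)
open import Data.Fin.Properties using (_≟_)
open import Data.List using (List; []; _∷_; _++_; [_]; length; filter; allFin)
open import Data.List.Membership.Propositional using (_∈_)
open import Data.List.Relation.Unary.Any using (Any; any?)
open import Data.List.Relation.Unary.All using (All)
open import Data.Maybe using (Maybe; nothing; just)
open import Data.Product using (_×_; _,_; proj₁; proj₂; Σ; ∃; ∃-syntax)
open import Data.Sum using (_⊎_)
open import Data.Unit using (⊤)
open import Relation.Binary.PropositionalEquality using (_≡_; _≢_)
open import Relation.Nullary using (¬_; Dec)
open import Relation.Nullary.Decidable using (_⊎-dec_; ¬?)

-- Vertices of K_n are Fin n; an edge is recorded as an ordered pair of
-- distinct vertices, and an (unordered) edge {x,y} is claimed by a list of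
-- pairs L if (x,y) or (y,x) occurs in L.
Edge : ℕ → Set
Edge n = Fin n × Fin n

module _ {n : ℕ} where

  Claimed : List (Edge n) → Fin n → Fin n → Set
  Claimed L x y = ((x , y) ∈ L) ⊎ ((y , x) ∈ L)

  Incident : Fin n → Edge n → Set
  Incident x e = (proj₁ e ≡ x) ⊎ (proj₂ e ≡ x)

  incident? : (x : Fin n) (e : Edge n) → Dec (Incident x e)
  incident? x e = (proj₁ e ≟ x) ⊎-dec (proj₂ e ≟ x)

  InV : List (Edge n) → Fin n → Set
  InV M x = Any (Incident x) M

  inV? : (M : List (Edge n)) (x : Fin n) → Dec (InV M x)
  inV? M x = any? (incident? x) M

  InU : List (Edge n) → Fin n → Set
  InU M x = ¬ InV M x

  sizeU : List (Edge n) → ℕ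
  sizeU M = length (filter (λ x → ¬? (inV? M x)) (allFin n))

  -- d_B(x): number of edges of B incident with x
  -- (B never contains the same edge twice, by construction of the moves below)
  deg : List (Edge n) → Fin n → ℕ
  deg B x = length (filter (incident? x) B)

  -- current position of a walker; nothing = has not moved yet
  At : Maybe (Fin n) → Fin n → Set
  At nothing  x = ⊤
  At (just v) x = x ≡ v

  record State : Set where
    constructor st
    field
      bpos : Maybe (Fin n)
      mpos : Maybe (Fin n)
      B    : List (Edge n)
      M    : List (Edge n)
  open State public

  initial : State
  initial = st nothing nothing [] []

  Free : State → Fin n → Fin n → Set
  Free s x y = (x ≢ y) × ¬ Claimed (B s) x y × ¬ Claimed (M s) x y

  -- A (legal) move of WBreaker: from his position (anywhere at the first move)
  -- along an edge not claimed by WMaker; if the edge is free he claims it,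
  -- if it is already his, he just walks along it.
  data BMove : State → State → Set where
    bclaim : ∀ {bp mp B M x y} → At bp x → Free (st bp mp B M) x y →
             BMove (st bp mp B M) (st (just y) mp (B ++ [ (x , y) ]) M)
    bwalk  : ∀ {bp mp B M x y} → At bp x → Claimed B x y →
             BMove (st bp mp B M) (st (just y) mp B M)

  makerClaims : State → Fin n → Fin n → State
  makerClaims s w y = st (bpos s) (just y) (B s) (M s ++ [ (w , y) ])

  BEdgeInU : State → Set
  BEdgeInU s = ∃[ p ] ∃[ q ] (Claimed (B s) p q × InU (M s) p × InU (M s) q)

  data SMove : State → State → Set where
    s-first : ∀ {s v₁ u} → mpos s ≡ nothing → bpos s ≡ just v₁ →
              deg (B s) u ≡ 0 → Free s v₁ u →
              SMove s (makerClaims s v₁ u)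
    -- there is pq ∈ E(B) with p,q ∈ U: claim wp (free), where if wq is also
    -- free then d_B(p) ≥ d_B(q)  (p, q symmetric, so this covers both cases)
    s-edgeU : ∀ {s w p q} → mpos s ≡ just w →
              Claimed (B s) p q → InU (M s) p → InU (M s) q →
              Free s w p → (Free s w q → deg (B s) q ≤ deg (B s) p) →
              SMove s (makerClaims s w p)
    s-max : ∀ {s w u} → mpos s ≡ just w → ¬ BEdgeInU s → 3 ≤ sizeU (M s) →
            InU (M s) u → Free s w u →
            (∀ v → InU (M s) v → deg (B s) v ≤ deg (B s) u) →
            SMove s (makerClaims s w u)
    s-arb : ∀ {s w u} → mpos s ≡ just w → ¬ BEdgeInU s → 3 ≤ sizeU (M s) →
            (∀ v → InU (M s) v → deg (B s) v ≡ 0) → Free s w u →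
            SMove s (makerClaims s w u)

  Round : State → State → Set
  Round s s″ = Σ State (λ s′ → BMove s s′ × SMove s′ s″)

  data Reachable : State → Set where
    r-init : Reachable initial
    r-step : ∀ {s s′} → Reachable s → Round s s′ → Reachable s′

  CoveredByVM : State → Set
  CoveredByVM s = All (λ e → InV (M s) (proj₁ e) ⊎ InV (M s) (proj₂ e)) (B s)

{-# OPTIONS --safe #-}
-- A
-- round adds one WBreaker edge xy, ending at WBreaker's position y.  In the
-- first round WMaker starts at y.  Otherwise, if x and y are both unvisited,
-- xy is the only WBreaker edge inside U (all older ones are covered), so
-- the strategy makes WMaker walk to an endpoint of xy; and if one of them is
-- visited, xy is covered already.  WMaker's edges only ever grow.
module Submission where

open import Defs
open import Data.Nat using (ℕ; _<_)
open import Data.List using (List; _++_; [_])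
open import Data.Maybe using (just)
open import Data.List.Relation.Unary.All as All using (All; []; _∷_)
open import Data.List.Relation.Unary.All.Properties as All using ()
open import Data.List.Relation.Unary.Any using (here)
open import Data.List.Relation.Unary.Any.Properties as Any using ()
open import Data.List.Membership.Propositional.Properties using (∈-++⁻; ∈-++⁺ʳ)
open import Data.Product using (_,_; proj₁; proj₂; ∃₂)
open import Data.Sum using (_⊎_; inj₁; inj₂; [_,_]′)
open import Data.Empty using (⊥-elim)
open import Relation.Nullary using (¬_; yes; no)
open import Relation.Binary.PropositionalEquality using (_≡_; refl)

module _ {n : ℕ} where

  Covers : List (Edge n) → Edge n → Set
  Covers M e = InV M (proj₁ e) ⊎ InV M (proj₂ e)

  inV-++-start : ∀ (M : List (Edge n)) {w y} → InV (M ++ [ (w , y) ]) w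
  inV-++-start M = Any.++⁺ʳ M (here (inj₁ refl))

  inV-++-end : ∀ (M : List (Edge n)) {w y} → InV (M ++ [ (w , y) ]) y
  inV-++-end M = Any.++⁺ʳ M (here (inj₂ refl))

  covers-++ : ∀ {M L : List (Edge n)} {e} → Covers M e → Covers (M ++ L) e
  covers-++ (inj₁ x∈V) = inj₁ (Any.++⁺ˡ x∈V)
  covers-++ (inj₂ y∈V) = inj₂ (Any.++⁺ˡ y∈V)

  covered-++ : ∀ {M L B : List (Edge n)} → All (Covers M) B → All (Covers (M ++ L)) B
  covered-++ = All.map covers-++

  covers-incident : ∀ {M : List (Edge n)} {x e} → Incident x e → InV M x → Covers M e
  covers-incident (inj₁ refl) x∈V = inj₁ x∈V
  covers-incident (inj₂ refl) x∈V = inj₂ x∈V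

  unvisited⇒¬covers : ∀ {M : List (Edge n)} {x y} → InU M x → InU M y → ¬ Covers M (x , y)
  unvisited⇒¬covers x∈U y∈U = [ x∈U , y∈U ]′

  ¬BEdgeInU⇒covers : ∀ {s : State {n}} {x y} → ¬ BEdgeInU s → Claimed (B s) x y →
                     Covers (M s) (x , y)
  ¬BEdgeInU⇒covers {s} {x} {y} ¬pq xy with inV? (M s) x | inV? (M s) y
  ... | yes x∈V | _       = inj₁ x∈V
  ... | no _    | yes y∈V = inj₂ y∈V
  ... | no x∈U  | no y∈U  = ⊥-elim (¬pq (x , y , xy , x∈U , y∈U))

  claimed-unvisited⇒incident-new : ∀ {M B : List (Edge n)} {e p q} → All (Covers M) B →
                                   Claimed (B ++ [ e ]) p q → InU M p → InU M q →
                                   Incident p e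
  claimed-unvisited⇒incident-new {B = B} cov (inj₁ pq∈) p∈U q∈U with ∈-++⁻ B pq∈
  ... | inj₁ pq∈B        = ⊥-elim (unvisited⇒¬covers p∈U q∈U (All.lookup cov pq∈B))
  ... | inj₂ (here refl) = inj₁ refl
  claimed-unvisited⇒incident-new {B = B} cov (inj₂ qp∈) p∈U q∈U with ∈-++⁻ B qp∈
  ... | inj₁ qp∈B        = ⊥-elim (unvisited⇒¬covers q∈U p∈U (All.lookup cov qp∈B))
  ... | inj₂ (here refl) = inj₂ refl

  smove-is-makerClaims : ∀ {s s′ : State {n}} → SMove s s′ → ∃₂ λ w y → s′ ≡ makerClaims s w y
  smove-is-makerClaims (s-first _ _ _ _)     = _ , _ , refl
  smove-is-makerClaims (s-edgeU _ _ _ _ _ _) = _ , _ , refl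
  smove-is-makerClaims (s-max _ _ _ _ _ _)   = _ , _ , refl
  smove-is-makerClaims (s-arb _ _ _ _ _)     = _ , _ , refl

  smove-covers-last-edge : ∀ {mp B M x y} {s′ : State {n}} → All (Covers M) B →
                           SMove (st (just y) mp (B ++ [ (x , y) ]) M) s′ →
                           Covers (State.M s′) (x , y)
  smove-covers-last-edge {M = M} cov (s-first _ refl _ _) = inj₂ (inV-++-start M)
  smove-covers-last-edge {M = M} cov (s-edgeU _ pq p∈U q∈U _ _) =
    covers-incident (claimed-unvisited⇒incident-new cov pq p∈U q∈U) (inV-++-end M)
  smove-covers-last-edge {mp} {B} {M} {x} {y} cov (s-max _ ¬pq _ _ _ _) =
    covers-++ (¬BEdgeInU⇒covers {st (just y) mp (B ++ [ (x , y) ]) M}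
                ¬pq (inj₁ (∈-++⁺ʳ B (here refl))))
  smove-covers-last-edge {mp} {B} {M} {x} {y} cov (s-arb _ ¬pq _ _ _) =
    covers-++ (¬BEdgeInU⇒covers {st (just y) mp (B ++ [ (x , y) ]) M}
                ¬pq (inj₁ (∈-++⁺ʳ B (here refl))))

  round-preserves-covered : ∀ {s s′ : State {n}} → CoveredByVM s → Round s s′ → CoveredByVM s′
  round-preserves-covered cov (_ , bmove , smove) with smove-is-makerClaims smove
  round-preserves-covered cov (_ , bwalk _ _ , smove)  | _ , _ , refl = covered-++ cov
  round-preserves-covered cov (_ , bclaim _ _ , smove) | _ , _ , refl =
    All.++⁺ (covered-++ cov) (smove-covers-last-edge cov smove ∷ [])

  reachable⇒covered : ∀ {s : State {n}} → Reachable s → CoveredByVM s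
  reachable⇒covered r-init         = []
  reachable⇒covered (r-step r rnd) = round-preserves-covered (reachable⇒covered r) rnd

lemma1 : (n : ℕ) (s : State {n}) → Reachable s → 2 < sizeU (M s) → CoveredByVM s
lemma1 n s reachable _ = reachable⇒covered reachable
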